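{- Let $m \ge 3$ be an odd integer and let $\Gamma = C_m \square C_{2m}$, viewed as the Cayley graph of $\mathbb{Z}_m \times \mathbb{Z}_{2m}$ with connection set $\{\pm(1,0),\pm(0,1)\}$. Suppose $\ell$ is a distance magic labeling of $\Gamma$, and write $\ell_{i,j}=\ell((i,j))$ (first index modulo $m$, second modulo $2m$). Then $\ell_{i,j} = -\ell_{i,j+m}$ for all $i,j$ with $0 \le i < m$, $0 \le j < 2m$.
   Context: For a positive integer $N$ let $\mathcal{N}_N=\{1-N,3-N,5-N,\ldots,N-1\}$. For a graph $\Gamma=(V,E)$ of order $N$, a distance magic labeling is a bijection $\ell: V \to \mathcal{N}_N$ such that for every vertex $v$ the sum of $\ell(u)$ over all neighbours $u$ of $v$ equals $0$. (A regular graph admits such a labeling iff it admits a bijection to $\{1,\dots,N\}$ with constant neighbour sums.) -}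

module Defs where

open import Data.Nat using (ℕ; suc; _+_; _*_; NonZero)
open import Data.Nat.DivMod using (_mod_)
open import Data.Fin using (Fin; toℕ)
open import Data.Integer using (ℤ; +_; _-_)
import Data.Integer as ℤ
open import Data.Product using (_×_; _,_)
open import Function.Bundles using (_⤖_; Bijection)

addMod : ∀ n .{{_ : NonZero n}} → Fin n → ℕ → Fin n
addMod n x k = (toℕ x + k) mod n

-- x + 1 and x - 1 (mod n); x - 1 ≡ x + (n - 1)
incMod decMod : ∀ n .{{_ : NonZero n}} → Fin n → Fin n
incMod n x = addMod n x 1
decMod (suc n) x = addMod (suc n) x n

-- The N-element label set  {1-N, 3-N, ..., N-1}: the k-th element (k = 0..N-1) is 2k+1-N.
labelOf : (N : ℕ) → Fin N → ℤ
labelOf N k = + (2 * toℕ k + 1) - + N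

Vertex : ℕ → Set
Vertex m = Fin m × Fin (2 * m)

neighbourSum : ∀ m .{{_ : NonZero m}} .{{_ : NonZero (2 * m)}} →
               (Vertex m → ℤ) → Vertex m → ℤ
neighbourSum m ℓ (i , j) =
  ℓ (incMod m i , j) ℤ.+ ℓ (decMod m i , j) ℤ.+
  ℓ (i , incMod (2 * m) j) ℤ.+ ℓ (i , decMod (2 * m) j)

-- A distance magic labeling of C_m □ C_{2m} (order N = 2m²): a bijection
-- ℓ : V → 𝒩_N, represented as ℓ = labelOf N ∘ σ with σ : V ⤖ Fin N a bijection,
-- such that every neighbour sum is 0.
IsDistanceMagic : ∀ m .{{_ : NonZero m}} .{{_ : NonZero (2 * m)}} → (Vertex m → ℤ) → Set
IsDistanceMagic m ℓ =
  Data.Product.Σ (Vertex m ⤖ Fin (2 * m * m)) λ σ →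
    ((v : Vertex m) → ℓ v Relation.Binary.PropositionalEquality.≡ labelOf (2 * m * m) (Bijection.to σ v))
    × ((v : Vertex m) → neighbourSum m ℓ v Relation.Binary.PropositionalEquality.≡ + 0)
  where import Relation.Binary.PropositionalEquality

{-# OPTIONS --safe #-}
-- Extend ℓ periodically to a function L on ℕ × ℕ. For G(a, b) = L(a+1, b) + L(a, b+1) the
-- neighbour sum of (a+1, b+1) reads G(a+1, b+1) + G(a, b) = 0, so G changes sign along the
-- diagonal; as m is odd and L has period m in a, G(a, b+m) = -G(a, b). Then
-- f(a, b) = L(a, b) + L(a, b+m) satisfies f(a+1, b) + f(a, b+1) = G(a, b) + G(a, b+m) = 0,
-- so f changes sign along (1, m-1); m such steps translate by (m, m(m-1)), a period of f,
-- hence f = -f = 0.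
module Submission where

open import Defs
open import Data.Fin using (Fin; toℕ)
open import Data.Fin.Properties using (toℕ-injective; toℕ-fromℕ<; toℕ<n)
open import Data.Integer using (ℤ; +_; -[1+_]; -_) renaming (_+_ to _+ℤ_)
open import Data.Integer.Properties
  using (neg-involutive; +-inverseʳ; +-0-abelianGroup; +-commutativeSemigroup)
  renaming (+-comm to +ℤ-comm)
import Data.Integer.Tactic.RingSolver as ℤ-Solver
open import Data.Nat using (ℕ; suc; zero; _+_; _*_; _/_; _≤_; NonZero)
open import Data.Nat.DivMod
  using (_%_; _mod_; %-distribˡ-+; m%n%n≡m%n; [m+n]%n≡m%n; m<n⇒m%n≡m; m≡m%n+[m/n]*n)
open import Data.Nat.Properties using (+-comm; +-suc; +-assoc; *-identityʳ; *-comm)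
import Data.Nat.Tactic.RingSolver as ℕ-Solver
open import Data.Product using (_,_)
open import Relation.Binary.PropositionalEquality
  using (_≡_; refl; sym; trans; cong; cong₂; module ≡-Reasoning)
open import Algebra.Properties.AbelianGroup +-0-abelianGroup using (inverseˡ-unique)
open import Algebra.Properties.CommutativeSemigroup +-commutativeSemigroup using (interchange)

odd⇒≡suc[m/2*2] : ∀ {m} → m % 2 ≡ 1 → m ≡ suc (m / 2 * 2)
odd⇒≡suc[m/2*2] {m} m-odd = trans (m≡m%n+[m/n]*n m 2) (cong (_+ m / 2 * 2) m-odd)

self-neg⇒0 : ∀ (x : ℤ) → x ≡ - x → x ≡ + 0
self-neg⇒0 (+ zero)  _  = refl
self-neg⇒0 (+ suc _) ()
self-neg⇒0 -[1+ _ ]    ()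

module _ (g : ℕ → ℤ) (alternating : ∀ x → g (suc x) ≡ - g x) where

  alternating-even : ∀ s → g (s * 2) ≡ g 0
  alternating-even zero    = refl
  alternating-even (suc s) = begin
    g (suc (suc (s * 2))) ≡⟨ alternating (suc (s * 2)) ⟩
    - g (suc (s * 2))     ≡⟨ cong -_ (alternating (s * 2)) ⟩
    - - g (s * 2)         ≡⟨ neg-involutive _ ⟩
    g (s * 2)             ≡⟨ alternating-even s ⟩
    g 0                   ∎
    where open ≡-Reasoning

  alternating-odd : ∀ s → g (suc (s * 2)) ≡ - g 0
  alternating-odd s = trans (alternating (s * 2)) (cong -_ (alternating-even s))

translate-odd : (h : ℕ → ℕ → ℤ) (c : ℕ) → (∀ a b → h (suc a) (c + b) ≡ - h a b) →
                ∀ {m} → m % 2 ≡ 1 → ∀ a b → h (m + a) (m * c + b) ≡ - h a b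
translate-odd h c step {m} m-odd a b =
  trans (cong (λ k → h (k + a) (k * c + b)) (odd⇒≡suc[m/2*2] m-odd))
        (alternating-odd (λ x → h (x + a) (x * c + b)) along-ray (m / 2))
  where
  along-ray : ∀ x → h (suc x + a) (suc x * c + b) ≡ - h (x + a) (x * c + b)
  along-ray x = trans (cong (h (suc (x + a))) (+-assoc c (x * c) b)) (step (x + a) (x * c + b))

periodic-multiple : (u : ℕ → ℤ) (p : ℕ) → (∀ b → u (p + b) ≡ u b) → ∀ k b → u (k * p + b) ≡ u b
periodic-multiple u p periodic zero    b = refl
periodic-multiple u p periodic (suc k) b =
  trans (cong u (+-assoc p (k * p) b)) (trans (periodic (k * p + b)) (periodic-multiple u p periodic k b))

module ZeroNeighbourSums
  (n : ℕ) (odd : suc n % 2 ≡ 1) (L : ℕ → ℕ → ℤ)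
  (periodic₁ : ∀ a b → L (suc n + a) b ≡ L a b)
  (periodic₂ : ∀ a b → L a (suc n + (suc n + b)) ≡ L a b)
  -- the neighbour sum at (a+1, b+1), so that no coordinate is decremented
  (zero-sum : ∀ a b → L (suc (suc a)) (suc b) +ℤ L a (suc b) +ℤ
                      L (suc a) (suc (suc b)) +ℤ L (suc a) b ≡ + 0)
  where

  G : ℕ → ℕ → ℤ
  G a b = L (suc a) b +ℤ L a (suc b)

  G-step : ∀ a b → G (suc a) (suc b) ≡ - G a b
  G-step a b = inverseˡ-unique (G (suc a) (suc b)) (G a b)
    (trans (regroup (L (suc (suc a)) (suc b)) (L a (suc b)) (L (suc a) (suc (suc b))) (L (suc a) b))
           (zero-sum a b))
    where
    regroup : ∀ x₁ x₂ x₃ x₄ → (x₁ +ℤ x₃) +ℤ (x₄ +ℤ x₂) ≡ x₁ +ℤ x₂ +ℤ x₃ +ℤ x₄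
    regroup = ℤ-Solver.solve-∀

  G-periodic₁ : ∀ a b → G (suc n + a) b ≡ G a b
  G-periodic₁ a b = cong₂ _+ℤ_
    (trans (cong (λ x → L x b) (sym (+-suc (suc n) a))) (periodic₁ (suc a) b))
    (periodic₁ a (suc b))

  G-antiperiodic₂ : ∀ a b → G a (suc n + b) ≡ - G a b
  G-antiperiodic₂ a b = begin
    G a (suc n + b)                   ≡⟨ G-periodic₁ a (suc n + b) ⟨
    G (suc n + a) (suc n + b)         ≡⟨ cong (λ k → G (suc n + a) (k + b)) (*-identityʳ (suc n)) ⟨
    G (suc n + a) (suc n * 1 + b)     ≡⟨ translate-odd G 1 G-step odd a b ⟩
    - G a b                           ∎
    where open ≡-Reasoning

  f : ℕ → ℕ → ℤ
  f a b = L a b +ℤ L a (suc n + b)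

  f-periodic₁ : ∀ a b → f (suc n + a) b ≡ f a b
  f-periodic₁ a b = cong₂ _+ℤ_ (periodic₁ a b) (periodic₁ a (suc n + b))

  f-periodic₂ : ∀ a b → f a (suc n + b) ≡ f a b
  f-periodic₂ a b = trans (cong (L a (suc n + b) +ℤ_) (periodic₂ a b)) (+ℤ-comm (L a (suc n + b)) (L a b))

  f-sum : ∀ a b → f (suc a) b +ℤ f a (suc b) ≡ + 0
  f-sum a b = begin
    f (suc a) b +ℤ f a (suc b)
      ≡⟨ cong (λ k → f (suc a) b +ℤ (L a (suc b) +ℤ L a k)) (+-suc (suc n) b) ⟩
    (L (suc a) b +ℤ L (suc a) (suc n + b)) +ℤ (L a (suc b) +ℤ L a (suc (suc n + b)))
      ≡⟨ interchange (L (suc a) b) (L (suc a) (suc n + b)) (L a (suc b)) (L a (suc (suc n + b))) ⟩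
    G a b +ℤ G a (suc n + b)
      ≡⟨ cong (G a b +ℤ_) (G-antiperiodic₂ a b) ⟩
    G a b +ℤ - G a b
      ≡⟨ +-inverseʳ (G a b) ⟩
    + 0 ∎
    where open ≡-Reasoning

  f-step : ∀ a b → f (suc a) (n + b) ≡ - f a b
  f-step a b = trans (inverseˡ-unique (f (suc a) (n + b)) (f a (suc n + b)) (f-sum a (n + b)))
                     (cong -_ (f-periodic₂ a b))

  f≡0 : ∀ a b → f a b ≡ + 0
  f≡0 a b = self-neg⇒0 (f a b) (begin
    f a b                              ≡⟨ periodic-multiple (f a) (suc n) (f-periodic₂ a) n b ⟨
    f a (n * suc n + b)                ≡⟨ cong (λ k → f a (k + b)) (*-comm n (suc n)) ⟩
    f a (suc n * n + b)                ≡⟨ f-periodic₁ a (suc n * n + b) ⟨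
    f (suc n + a) (suc n * n + b)      ≡⟨ translate-odd f n f-step odd a b ⟩
    - f a b                            ∎)
    where open ≡-Reasoning

  antiperiodic₂ : ∀ a b → L a b ≡ - L a (suc n + b)
  antiperiodic₂ a b = inverseˡ-unique (L a b) (L a (suc n + b)) (f≡0 a b)

mod-cong : ∀ d .{{_ : NonZero d}} {a b} → a % d ≡ b % d → a mod d ≡ b mod d
mod-cong d eq = toℕ-injective (trans (toℕ-fromℕ< _) (trans eq (sym (toℕ-fromℕ< _))))

toℕ-mod : ∀ d .{{_ : NonZero d}} (i : Fin d) → toℕ i mod d ≡ i
toℕ-mod d i = toℕ-injective (trans (toℕ-fromℕ< _) (m<n⇒m%n≡m (toℕ<n i)))

mod-periodic : ∀ d .{{_ : NonZero d}} a → (d + a) mod d ≡ a mod d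
mod-periodic d a = mod-cong d (trans (cong (_% d) (+-comm d a)) ([m+n]%n≡m%n a d))

addMod-mod : ∀ d .{{_ : NonZero d}} a k → addMod d (a mod d) k ≡ (a + k) mod d
addMod-mod d a k = mod-cong d (begin
    (toℕ (a mod d) + k) % d        ≡⟨ cong (λ x → (x + k) % d) (toℕ-fromℕ< _) ⟩
    (a % d + k) % d                ≡⟨ %-distribˡ-+ (a % d) k d ⟩
    (a % d % d + k % d) % d        ≡⟨ cong (λ x → (x + k % d) % d) (m%n%n≡m%n a d) ⟩
    (a % d + k % d) % d            ≡⟨ %-distribˡ-+ a k d ⟨
    (a + k) % d                    ∎)
  where open ≡-Reasoning

incMod-mod : ∀ d .{{_ : NonZero d}} a → incMod d (a mod d) ≡ suc a mod d
incMod-mod d a = trans (addMod-mod d a 1) (cong (_mod d) (+-comm a 1))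

decMod-mod : ∀ d .{{_ : NonZero d}} a → decMod d (suc a mod d) ≡ a mod d
decMod-mod (suc k) a = begin
  addMod (suc k) (suc a mod suc k) k  ≡⟨ addMod-mod (suc k) (suc a) k ⟩
  suc (a + k) mod suc k               ≡⟨ cong (λ x → suc x mod suc k) (+-comm a k) ⟩
  (suc k + a) mod suc k               ≡⟨ mod-periodic (suc k) a ⟩
  a mod suc k                         ∎
  where open ≡-Reasoning

module _ (m : ℕ) .{{_ : NonZero m}} .{{_ : NonZero (2 * m)}} (ℓ : Vertex m → ℤ) where

  periodicExtension : ℕ → ℕ → ℤ
  periodicExtension a b = ℓ (a mod m , b mod (2 * m))

  periodicExtension-periodic₁ : ∀ a b → periodicExtension (m + a) b ≡ periodicExtension a b
  periodicExtension-periodic₁ a b = cong (λ x → ℓ (x , b mod (2 * m))) (mod-periodic m a)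

  periodicExtension-periodic₂ : ∀ a b → periodicExtension a (m + (m + b)) ≡ periodicExtension a b
  periodicExtension-periodic₂ a b =
    cong (λ y → ℓ (a mod m , y)) (trans (cong (_mod (2 * m)) (double-shift m b)) (mod-periodic (2 * m) b))
    where
    double-shift : ∀ m b → m + (m + b) ≡ 2 * m + b
    double-shift = ℕ-Solver.solve-∀

  neighbourSum≡periodicExtension : ∀ a b →
    neighbourSum m ℓ (suc a mod m , suc b mod (2 * m)) ≡
    periodicExtension (suc (suc a)) (suc b) +ℤ periodicExtension a (suc b) +ℤ
    periodicExtension (suc a) (suc (suc b)) +ℤ periodicExtension (suc a) b
  neighbourSum≡periodicExtension a b =
    cong₂ _+ℤ_ (cong₂ _+ℤ_ (cong₂ _+ℤ_
      (cong (λ x → ℓ (x , suc b mod (2 * m))) (incMod-mod m (suc a)))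
      (cong (λ x → ℓ (x , suc b mod (2 * m))) (decMod-mod m a)))
      (cong (λ y → ℓ (suc a mod m , y)) (incMod-mod (2 * m) (suc b))))
      (cong (λ y → ℓ (suc a mod m , y)) (decMod-mod (2 * m) b))

  ℓ≡periodicExtension : ∀ i j → ℓ (i , j) ≡ periodicExtension (toℕ i) (toℕ j)
  ℓ≡periodicExtension i j = sym (cong₂ (λ x y → ℓ (x , y)) (toℕ-mod m i) (toℕ-mod (2 * m) j))

  ℓ-shift≡periodicExtension : ∀ i j k →
    ℓ (i , addMod (2 * m) j k) ≡ periodicExtension (toℕ i) (k + toℕ j)
  ℓ-shift≡periodicExtension i j k =
    sym (cong₂ (λ x y → ℓ (x , y)) (toℕ-mod m i) (cong (_mod (2 * m)) (+-comm k (toℕ j))))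

corollary2p3 : (m : ℕ) .{{_ : NonZero m}} .{{_ : NonZero (2 Data.Nat.* m)}} →
    3 ≤ m → m % 2 ≡ 1 → (ℓ : Vertex m → ℤ) → IsDistanceMagic m ℓ →
    (i : Fin m) (j : Fin (2 Data.Nat.* m)) → ℓ (i , j) ≡ - ℓ (i , addMod (2 Data.Nat.* m) j m)
corollary2p3 m@(suc n) _ odd ℓ (_ , _ , zero-sums) i j = begin
  ℓ (i , j)                                 ≡⟨ ℓ≡periodicExtension m ℓ i j ⟩
  L (toℕ i) (toℕ j)                         ≡⟨ antiperiodic₂ (toℕ i) (toℕ j) ⟩
  - L (toℕ i) (m + toℕ j)                   ≡⟨ cong -_ (ℓ-shift≡periodicExtension m ℓ i j m) ⟨
  - ℓ (i , addMod (2 * m) j m)              ∎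
  where
  open ≡-Reasoning
  L : ℕ → ℕ → ℤ
  L = periodicExtension m ℓ
  open ZeroNeighbourSums n odd L (periodicExtension-periodic₁ m ℓ) (periodicExtension-periodic₂ m ℓ)
    (λ a b → trans (sym (neighbourSum≡periodicExtension m ℓ a b)) (zero-sums _))
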